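{- (Soundness of the memoized proof search.) For every natural number $n$, all annotated terms $g,d$, and every memo map $M$: if $M$ is correct, then, writing $(b,M')=\mathrm{decideMemo}(n,g,d,M)$, (i) $M'$ is correct, and (ii) if $b=\mathrm{true}$ then there exists a natural number $n_0$ with $\mathrm{decide}(n_0,g,d)=\mathrm{true}$.
   Context: Terms: generated from variables $x_p$ ($p$ a positive integer) by binary $\wedge$, binary $\vee$ and unary $\neg$. Annotated terms: $N$, $L(t)$, $R(t)$ for terms $t$. The (unmemoized) boolean function $\mathrm{decide}(n,g,d)$: $\mathrm{decide}(0,g,d)=\mathrm{false}$, and $\mathrm{decide}(n+1,g,d)=\mathrm{true}$ iff at least one of the following holds (writing $D=\mathrm{decide}(n,\cdot,\cdot)$): $g=L(x_p)$, $d=R(x_q)$, $p=q$; $D(g,N)$; $d=N$ and $D(g,g)$; $g=L(a\wedge b)$ and $D(L(a),d)$; $g=L(a\wedge b)$ and $D(L(b),d)$; $g=L(a\vee b)$ and $D(L(a),d)$ and $D(L(b),d)$; $g=L(\neg a)$ and $D(R(a),d)$; $d=R(a\vee b)$ and $D(g,R(a))$; $d=R(a\vee b)$ and $D(g,R(b))$; $d=R(a\wedge b)$ and $D(g,R(a))$ and $D(g,R(b))$; $d=R(\neg a)$ and $D(g,L(a))$; $D(d,g)$. A memo map is a finite map from pairs of annotated terms to booleans, with lookup $\mathrm{find}$ and insertion $\mathrm{update}$ (satisfying the usual map laws). A memo map $M$ is correct if for every pair $(g,d)$ with $\mathrm{find}((g,d),M)=\mathrm{true}$ there exists $n$ with $\mathrm{decide}(n,g,d)=\mathrm{true}$.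 Stateful connectives on computations $c:\mathrm{Map}\to\mathrm{bool}\times\mathrm{Map}$: $\mathrm{mor}(c_1,c_2)(M)$ runs $c_1$ on $M$ giving $(b,M_1)$; if $b=\mathrm{true}$ it returns $(\mathrm{true},M_1)$, else returns $c_2(M_1)$. $\mathrm{mand}(c_1,c_2)(M)$: runs $c_1$ giving $(b,M_1)$; if $b=\mathrm{false}$ returns $(\mathrm{false},M_1)$, else returns $c_2(M_1)$. $\mathrm{decideMemo}(n,g,d,M)$: if $\mathrm{find}((g,d),M)=b$ is defined, return $(b,M)$. Otherwise compute $(b,M_1)$ as follows and return $(b,\mathrm{update}((g,d),b,M_1))$: if $n=0$, $(b,M_1)=(\mathrm{false},M)$; if $n=k+1$, $(b,M_1)$ is obtained by evaluating on $M$ the same disjunction of cases as in the definition of $\mathrm{decide}(k+1,g,d)$ (in the same order), where each non-applicable case yields $\mathrm{false}$ without changing the map, each recursive call $D(g',d')$ is replaced by the computation $M''\mapsto\mathrm{decideMemo}(k,g',d',M'')$, disjunctions are combined with $\mathrm{mor}$ and conjunctions with $\mathrm{mand}$. -}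

module Defs where

open import Data.Nat using (ℕ; zero; suc; _≟_)
open import Data.Bool using (Bool; true; false; _∨_; _∧_)
open import Data.Maybe using (Maybe; just; nothing)
open import Data.Product using (_×_; _,_; ∃)
open import Relation.Nullary using (¬_)
open import Relation.Nullary.Decidable using (⌊_⌋)
open import Relation.Binary.PropositionalEquality using (_≡_)

-- Terms.  `var p` stands for the variable x_(p+1), so variables are
-- indexed by positive integers as in the paper (index shift only).
infixr 6 _∧ₜ_
infixr 5 _∨ₜ_
data Term : Set where
  var  : ℕ → Term
  _∧ₜ_ : Term → Term → Term
  _∨ₜ_ : Term → Term → Term
  ¬ₜ_  : Term → Term

data ATerm : Set where
  N : ATerm
  L : Term → ATerm
  R : Term → ATerm

Key : Set
Key = ATerm × ATerm

-- The disjunction of cases of decide(k+1,g,d), written once, generically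
-- over the kind of "computation" C: `or`/`and` combine cases, `pure b`
-- is a constant result (non-applicable case = pure false), and D is the
-- recursive call.

module Cases {C : Set} (or and : C → C → C) (pure : Bool → C)
             (D : ATerm → ATerm → C) where

  c-axiom : ATerm → ATerm → C
  c-axiom (L (var p)) (R (var q)) = pure ⌊ p ≟ q ⌋
  c-axiom _ _ = pure false

  c-N : ATerm → ATerm → C
  c-N g d = D g N

  c-NN : ATerm → ATerm → C
  c-NN g N = D g g
  c-NN _ _ = pure false

  c-L∧₁ : ATerm → ATerm → C
  c-L∧₁ (L (a ∧ₜ b)) d = D (L a) d
  c-L∧₁ _ _ = pure false

  c-L∧₂ : ATerm → ATerm → C
  c-L∧₂ (L (a ∧ₜ b)) d = D (L b) d
  c-L∧₂ _ _ = pure false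

  c-L∨ : ATerm → ATerm → C
  c-L∨ (L (a ∨ₜ b)) d = and (D (L a) d) (D (L b) d)
  c-L∨ _ _ = pure false

  c-L¬ : ATerm → ATerm → C
  c-L¬ (L (¬ₜ a)) d = D (R a) d
  c-L¬ _ _ = pure false

  c-R∨₁ : ATerm → ATerm → C
  c-R∨₁ g (R (a ∨ₜ b)) = D g (R a)
  c-R∨₁ _ _ = pure false

  c-R∨₂ : ATerm → ATerm → C
  c-R∨₂ g (R (a ∨ₜ b)) = D g (R b)
  c-R∨₂ _ _ = pure false

  c-R∧ : ATerm → ATerm → C
  c-R∧ g (R (a ∧ₜ b)) = and (D g (R a)) (D g (R b))
  c-R∧ _ _ = pure false

  c-R¬ : ATerm → ATerm → C
  c-R¬ g (R (¬ₜ a)) = D g (L a)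
  c-R¬ _ _ = pure false

  c-swap : ATerm → ATerm → C
  c-swap g d = D d g

  cases : ATerm → ATerm → C
  cases g d =
    or (c-axiom g d)
    (or (c-N g d)
    (or (c-NN g d)
    (or (c-L∧₁ g d)
    (or (c-L∧₂ g d)
    (or (c-L∨ g d)
    (or (c-L¬ g d)
    (or (c-R∨₁ g d)
    (or (c-R∨₂ g d)
    (or (c-R∧ g d)
    (or (c-R¬ g d)
        (c-swap g d)))))))))))

decide : ℕ → ATerm → ATerm → Bool
decide zero    g d = false
decide (suc n) g d = Cases.cases _∨_ _∧_ (λ b → b) (decide n) g d

record MemoMap : Set₁ where
  field
    Map    : Set
    empty  : Map
    find   : Key → Map → Maybe Bool
    update : Key → Bool → Map → Map
    find-empty     : ∀ k → find k empty ≡ nothing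
    find-update-≡  : ∀ k b m → find k (update k b m) ≡ just b
    find-update-≢  : ∀ k k′ b m → ¬ (k ≡ k′) → find k′ (update k b m) ≡ find k′ m

module Memo (MM : MemoMap) where
  open MemoMap MM

  Comp : Set
  Comp = Map → Bool × Map

  mor : Comp → Comp → Comp
  mor c₁ c₂ M with c₁ M
  ... | true  , M₁ = true , M₁
  ... | false , M₁ = c₂ M₁

  mand : Comp → Comp → Comp
  mand c₁ c₂ M with c₁ M
  ... | false , M₁ = false , M₁
  ... | true  , M₁ = c₂ M₁

  ret : Bool → Comp
  ret b M = b , M

  Correct : Map → Set
  Correct M = ∀ g d → find (g , d) M ≡ just true → ∃ λ n → decide n g d ≡ true

  store : ATerm → ATerm → Bool × Map → Bool × Map
  store g d (b , M₁) = b , update (g , d) b M₁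

  decideMemo : ℕ → ATerm → ATerm → Map → Bool × Map
  decideMemo n g d M with find (g , d) M
  decideMemo n       g d M | just b  = b , M
  decideMemo zero    g d M | nothing = store g d (false , M)
  decideMemo (suc k) g d M | nothing =
    store g d (Cases.cases mor mand ret (λ g′ d′ M″ → decideMemo k g′ d′ M″) g d M)

{-# OPTIONS --safe #-}
module Submission where

-- `decide (suc n)` and one step of `decideMemo (suc n)` evaluate the same
-- disjunction `Cases.cases`, only in different interpretations of `or`, `and`,
-- `pure` and the recursive call; so any relation between two interpretations
-- that these four respect is respected by `cases` (parametricity).  Three
-- instances carry the proof: implication of truth values makes `decide`
-- monotone in the fuel; evaluation at n identifies the pointwise interpretation
-- on fuel-indexed sequences with `decide (suc n)`; and "preserves correct memo
-- maps, and answers true only if the sequence is eventually true" relates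
-- memoized computations to those sequences.  By monotonicity, "eventually true"
-- and "true for some fuel" coincide, and the latter is what correctness asks.

open import Defs
open import Data.Nat using (ℕ; zero; suc; _≤_; s≤s; _≤′_; ≤′-refl; ≤′-step; _⊔_; _≟_)
open import Data.Nat.Properties using (≤-refl; ≤-trans; m≤m⊔n; m≤n⊔m; ≤⇒≤′)
open import Data.Bool using (Bool; true; false; _∨_; _∧_)
open import Data.Bool.Properties using (∨-zeroʳ)
open import Data.Maybe using (just; nothing)
open import Data.Maybe.Properties using (just-injective)
open import Data.Product using (_×_; _,_; ∃; proj₁; proj₂; map₂; uncurry)
open import Data.Product.Properties using (≡-dec)
open import Function using (_∘_; id; const)
open import Relation.Nullary using (yes; no)
open import Relation.Nullary.Decidable using (map′; _×-dec_)
open import Relation.Binary.Definitions using (DecidableEquality)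
open import Relation.Binary.PropositionalEquality using (_≡_; refl; sym; trans; cong; cong₂)

∨-introˡ : ∀ {x y} → x ≡ true → x ∨ y ≡ true
∨-introˡ refl = refl

∨-introʳ : ∀ {x y} → y ≡ true → x ∨ y ≡ true
∨-introʳ {x} refl = ∨-zeroʳ x

∧-intro : ∀ {x y} → x ≡ true → y ≡ true → x ∧ y ≡ true
∧-intro refl refl = refl

∨-mono : ∀ {x x′ y y′} → (x ≡ true → x′ ≡ true) → (y ≡ true → y′ ≡ true) →
         x ∨ y ≡ true → x′ ∨ y′ ≡ true
∨-mono {true}  x⇒x′ _    _   = ∨-introˡ (x⇒x′ refl)
∨-mono {false} _    y⇒y′ y≡t = ∨-introʳ (y⇒y′ y≡t)

∧-mono : ∀ {x x′ y y′} → (x ≡ true → x′ ≡ true) → (y ≡ true → y′ ≡ true) →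
         x ∧ y ≡ true → x′ ∧ y′ ≡ true
∧-mono {true}  {y = true}  x⇒x′ y⇒y′ _ = ∧-intro (x⇒x′ refl) (y⇒y′ refl)
∧-mono {true}  {y = false} _    _    ()
∧-mono {false}             _    _    ()

Eventually : (ℕ → Set) → Set
Eventually P = ∃ λ n → ∀ {m} → n ≤ m → P m

eventually-map : ∀ {P Q : ℕ → Set} → (∀ {n} → P n → Q n) → Eventually P → Eventually Q
eventually-map P⇒Q (n , P) = n , P⇒Q ∘ P

eventually-zip : ∀ {P Q : ℕ → Set} → Eventually P → Eventually Q →
                 Eventually (λ n → P n × Q n)
eventually-zip (n₁ , P) (n₂ , Q) =
  n₁ ⊔ n₂ , λ n₁⊔n₂≤m → P (≤-trans (m≤m⊔n n₁ n₂) n₁⊔n₂≤m) , Q (≤-trans (m≤n⊔m n₁ n₂) n₁⊔n₂≤m)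

eventually-suc⁻ : ∀ {P : ℕ → Set} → Eventually (P ∘ suc) → Eventually P
eventually-suc⁻ {P} (n , P∘suc) = suc n , step
  where
  step : ∀ {m} → suc n ≤ m → P m
  step {suc m} (s≤s n≤m) = P∘suc n≤m

eventually-monotone : ∀ {P : ℕ → Set} → (∀ {n} → P n → P (suc n)) →
                      ∀ {n} → P n → Eventually P
eventually-monotone {P} P-step {n} Pn = n , P-from ∘ ≤⇒≤′
  where
  P-from : ∀ {m} → n ≤′ m → P m
  P-from ≤′-refl        = Pn
  P-from (≤′-step n≤m) = P-step (P-from n≤m)

module Parametricity
  {C C′ : Set} (_∼_ : C → C′ → Set)
  (or and : C → C → C) (pure : Bool → C) (D : ATerm → ATerm → C)
  (or′ and′ : C′ → C′ → C′) (pure′ : Bool → C′) (D′ : ATerm → ATerm → C′)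
  (or-∼   : ∀ {x x′ y y′} → x ∼ x′ → y ∼ y′ → or x y ∼ or′ x′ y′)
  (and-∼  : ∀ {x x′ y y′} → x ∼ x′ → y ∼ y′ → and x y ∼ and′ x′ y′)
  (pure-∼ : ∀ b → pure b ∼ pure′ b)
  (D-∼    : ∀ g d → D g d ∼ D′ g d)
  where

  private
    module S = Cases or and pure D
    module S′ = Cases or′ and′ pure′ D′

    false-∼ : pure false ∼ pure′ false
    false-∼ = pure-∼ false

    axiom-∼ : ∀ g d → S.c-axiom g d ∼ S′.c-axiom g d
    axiom-∼ (L (var p))  (R (var q))  = pure-∼ _
    axiom-∼ (L (var _))  (R (_ ∧ₜ _)) = false-∼
    axiom-∼ (L (var _))  (R (_ ∨ₜ _)) = false-∼
    axiom-∼ (L (var _))  (R (¬ₜ _))   = false-∼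
    axiom-∼ (L (var _))  (L _)        = false-∼
    axiom-∼ (L (var _))  N            = false-∼
    axiom-∼ (L (_ ∧ₜ _)) _            = false-∼
    axiom-∼ (L (_ ∨ₜ _)) _            = false-∼
    axiom-∼ (L (¬ₜ _))   _            = false-∼
    axiom-∼ (R _)        _            = false-∼
    axiom-∼ N            _            = false-∼

    NN-∼ : ∀ g d → S.c-NN g d ∼ S′.c-NN g d
    NN-∼ g N     = D-∼ g g
    NN-∼ _ (L _) = false-∼
    NN-∼ _ (R _) = false-∼

    L∧₁-∼ : ∀ g d → S.c-L∧₁ g d ∼ S′.c-L∧₁ g d
    L∧₁-∼ (L (a ∧ₜ _)) d = D-∼ (L a) d
    L∧₁-∼ (L (var _))  _ = false-∼
    L∧₁-∼ (L (_ ∨ₜ _)) _ = false-∼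
    L∧₁-∼ (L (¬ₜ _))   _ = false-∼
    L∧₁-∼ (R _)        _ = false-∼
    L∧₁-∼ N            _ = false-∼

    L∧₂-∼ : ∀ g d → S.c-L∧₂ g d ∼ S′.c-L∧₂ g d
    L∧₂-∼ (L (_ ∧ₜ b)) d = D-∼ (L b) d
    L∧₂-∼ (L (var _))  _ = false-∼
    L∧₂-∼ (L (_ ∨ₜ _)) _ = false-∼
    L∧₂-∼ (L (¬ₜ _))   _ = false-∼
    L∧₂-∼ (R _)        _ = false-∼
    L∧₂-∼ N            _ = false-∼

    L∨-∼ : ∀ g d → S.c-L∨ g d ∼ S′.c-L∨ g d
    L∨-∼ (L (a ∨ₜ b)) d = and-∼ (D-∼ (L a) d) (D-∼ (L b) d)
    L∨-∼ (L (var _))  _ = false-∼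
    L∨-∼ (L (_ ∧ₜ _)) _ = false-∼
    L∨-∼ (L (¬ₜ _))   _ = false-∼
    L∨-∼ (R _)        _ = false-∼
    L∨-∼ N            _ = false-∼

    L¬-∼ : ∀ g d → S.c-L¬ g d ∼ S′.c-L¬ g d
    L¬-∼ (L (¬ₜ a))   d = D-∼ (R a) d
    L¬-∼ (L (var _))  _ = false-∼
    L¬-∼ (L (_ ∧ₜ _)) _ = false-∼
    L¬-∼ (L (_ ∨ₜ _)) _ = false-∼
    L¬-∼ (R _)        _ = false-∼
    L¬-∼ N            _ = false-∼

    R∨₁-∼ : ∀ g d → S.c-R∨₁ g d ∼ S′.c-R∨₁ g d
    R∨₁-∼ g (R (a ∨ₜ _)) = D-∼ g (R a)
    R∨₁-∼ _ (R (var _))  = false-∼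
    R∨₁-∼ _ (R (_ ∧ₜ _)) = false-∼
    R∨₁-∼ _ (R (¬ₜ _))   = false-∼
    R∨₁-∼ _ (L _)        = false-∼
    R∨₁-∼ _ N            = false-∼

    R∨₂-∼ : ∀ g d → S.c-R∨₂ g d ∼ S′.c-R∨₂ g d
    R∨₂-∼ g (R (_ ∨ₜ b)) = D-∼ g (R b)
    R∨₂-∼ _ (R (var _))  = false-∼
    R∨₂-∼ _ (R (_ ∧ₜ _)) = false-∼
    R∨₂-∼ _ (R (¬ₜ _))   = false-∼
    R∨₂-∼ _ (L _)        = false-∼
    R∨₂-∼ _ N            = false-∼

    R∧-∼ : ∀ g d → S.c-R∧ g d ∼ S′.c-R∧ g d
    R∧-∼ g (R (a ∧ₜ b)) = and-∼ (D-∼ g (R a)) (D-∼ g (R b))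
    R∧-∼ _ (R (var _))  = false-∼
    R∧-∼ _ (R (_ ∨ₜ _)) = false-∼
    R∧-∼ _ (R (¬ₜ _))   = false-∼
    R∧-∼ _ (L _)        = false-∼
    R∧-∼ _ N            = false-∼

    R¬-∼ : ∀ g d → S.c-R¬ g d ∼ S′.c-R¬ g d
    R¬-∼ g (R (¬ₜ a))   = D-∼ g (L a)
    R¬-∼ _ (R (var _))  = false-∼
    R¬-∼ _ (R (_ ∧ₜ _)) = false-∼
    R¬-∼ _ (R (_ ∨ₜ _)) = false-∼
    R¬-∼ _ (L _)        = false-∼
    R¬-∼ _ N            = false-∼

  cases-∼ : ∀ g d → S.cases g d ∼ S′.cases g d
  cases-∼ g d =
    or-∼ (axiom-∼ g d) (or-∼ (D-∼ g N) (or-∼ (NN-∼ g d) (or-∼ (L∧₁-∼ g d)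
    (or-∼ (L∧₂-∼ g d) (or-∼ (L∨-∼ g d) (or-∼ (L¬-∼ g d) (or-∼ (R∨₁-∼ g d)
    (or-∼ (R∨₂-∼ g d) (or-∼ (R∧-∼ g d) (or-∼ (R¬-∼ g d) (D-∼ d g)))))))))))

Derivable : ATerm → ATerm → Set
Derivable g d = ∃ λ n → decide n g d ≡ true

decideAt : ATerm → ATerm → ℕ → Bool
decideAt g d n = decide n g d

EventuallyTrue : (ℕ → Bool) → Set
EventuallyTrue f = Eventually (λ n → f n ≡ true)

_∨̇_ _∧̇_ : (ℕ → Bool) → (ℕ → Bool) → ℕ → Bool
(f ∨̇ f′) n = f n ∨ f′ n
(f ∧̇ f′) n = f n ∧ f′ n

module Pointwise = Cases _∨̇_ _∧̇_ const decideAt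

pointwise-cases : ∀ n g d → Pointwise.cases g d n ≡ decide (suc n) g d
pointwise-cases n =
  Parametricity.cases-∼ (λ f b → f n ≡ b) _∨̇_ _∧̇_ const decideAt _∨_ _∧_ id (decide n)
    (cong₂ _∨_) (cong₂ _∧_) (λ _ → refl) (λ _ _ → refl)

decide-suc-mono : ∀ n g d → decide n g d ≡ true → decide (suc n) g d ≡ true
decide-suc-mono zero    _ _ ()
decide-suc-mono (suc n) =
  Parametricity.cases-∼ (λ x y → x ≡ true → y ≡ true)
    _∨_ _∧_ id (decide n) _∨_ _∧_ id (decide (suc n))
    ∨-mono ∧-mono (λ _ → id) (decide-suc-mono n)

derivable⇒eventuallyTrue : ∀ {g d} → Derivable g d → EventuallyTrue (decideAt g d)
derivable⇒eventuallyTrue (n , decide≡true) =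
  eventually-monotone (λ {m} → decide-suc-mono m _ _) {n} decide≡true

eventuallyTrue⇒derivable : ∀ {g d} → EventuallyTrue (decideAt g d) → Derivable g d
eventuallyTrue⇒derivable (n , decide≡true) = n , decide≡true ≤-refl

eventuallyTrue-pointwise-cases : ∀ {g d} → EventuallyTrue (Pointwise.cases g d) →
                                 EventuallyTrue (decideAt g d)
eventuallyTrue-pointwise-cases {g} {d} =
  eventually-suc⁻ ∘ eventually-map (λ {n} → trans (sym (pointwise-cases n g d)))

_≟ₜ_ : DecidableEquality Term
var p    ≟ₜ var q    = map′ (cong var) (λ { refl → refl }) (p ≟ q)
(a ∧ₜ b) ≟ₜ (c ∧ₜ e) = map′ (uncurry (cong₂ _∧ₜ_)) (λ { refl → refl , refl }) (a ≟ₜ c ×-dec b ≟ₜ e)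
(a ∨ₜ b) ≟ₜ (c ∨ₜ e) = map′ (uncurry (cong₂ _∨ₜ_)) (λ { refl → refl , refl }) (a ≟ₜ c ×-dec b ≟ₜ e)
(¬ₜ a)   ≟ₜ (¬ₜ c)   = map′ (cong ¬ₜ_) (λ { refl → refl }) (a ≟ₜ c)
var _    ≟ₜ (_ ∧ₜ _) = no λ ()
var _    ≟ₜ (_ ∨ₜ _) = no λ ()
var _    ≟ₜ (¬ₜ _)   = no λ ()
(_ ∧ₜ _) ≟ₜ var _    = no λ ()
(_ ∧ₜ _) ≟ₜ (_ ∨ₜ _) = no λ ()
(_ ∧ₜ _) ≟ₜ (¬ₜ _)   = no λ ()
(_ ∨ₜ _) ≟ₜ var _    = no λ ()
(_ ∨ₜ _) ≟ₜ (_ ∧ₜ _) = no λ ()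
(_ ∨ₜ _) ≟ₜ (¬ₜ _)   = no λ ()
(¬ₜ _)   ≟ₜ var _    = no λ ()
(¬ₜ _)   ≟ₜ (_ ∧ₜ _) = no λ ()
(¬ₜ _)   ≟ₜ (_ ∨ₜ _) = no λ ()

_≟ₐ_ : DecidableEquality ATerm
N   ≟ₐ N   = yes refl
L s ≟ₐ L t = map′ (cong L) (λ { refl → refl }) (s ≟ₜ t)
R s ≟ₐ R t = map′ (cong R) (λ { refl → refl }) (s ≟ₜ t)
N   ≟ₐ L _ = no λ ()
N   ≟ₐ R _ = no λ ()
L _ ≟ₐ N   = no λ ()
L _ ≟ₐ R _ = no λ ()
R _ ≟ₐ N   = no λ ()
R _ ≟ₐ L _ = no λ ()

_≟ₖ_ : DecidableEquality Key
_≟ₖ_ = ≡-dec _≟ₐ_ _≟ₐ_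

module _ (MM : MemoMap) where
  open MemoMap MM
  open Memo MM

  Sound : Comp → (ℕ → Bool) → Set
  Sound c f = ∀ M → Correct M →
              Correct (proj₂ (c M)) × (proj₁ (c M) ≡ true → EventuallyTrue f)

  sound-weaken : ∀ {c f f′} → (EventuallyTrue f → EventuallyTrue f′) → Sound c f → Sound c f′
  sound-weaken f⇒f′ c-sound M M-correct = map₂ (f⇒f′ ∘_) (c-sound M M-correct)

  mor-sound : ∀ {c₁ c₂ f₁ f₂} → Sound c₁ f₁ → Sound c₂ f₂ → Sound (mor c₁ c₂) (f₁ ∨̇ f₂)
  mor-sound {c₁} c₁-sound c₂-sound M M-correct with c₁ M | c₁-sound M M-correct
  ... | true  , _  | M₁-correct , f₁-true =
    M₁-correct , λ _ → eventually-map ∨-introˡ (f₁-true refl)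
  ... | false , M₁ | M₁-correct , _ =
    sound-weaken (eventually-map ∨-introʳ) c₂-sound M₁ M₁-correct

  mand-sound : ∀ {c₁ c₂ f₁ f₂} → Sound c₁ f₁ → Sound c₂ f₂ → Sound (mand c₁ c₂) (f₁ ∧̇ f₂)
  mand-sound {c₁} c₁-sound c₂-sound M M-correct with c₁ M | c₁-sound M M-correct
  ... | false , _  | M₁-correct , _ = M₁-correct , λ ()
  ... | true  , M₁ | M₁-correct , f₁-true =
    sound-weaken (eventually-map (uncurry ∧-intro) ∘ eventually-zip (f₁-true refl))
                 c₂-sound M₁ M₁-correct

  ret-sound : ∀ b → Sound (ret b) (const b)
  ret-sound b M M-correct = M-correct , λ b≡true → 0 , const b≡true

  update-correct : ∀ {M} g d b → Correct M → (b ≡ true → Derivable g d) →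
                   Correct (update (g , d) b M)
  update-correct {M} g d b M-correct b-derivable g′ d′ found with (g , d) ≟ₖ (g′ , d′)
  ... | yes refl = b-derivable (just-injective (trans (sym (find-update-≡ (g , d) b M)) found))
  ... | no  k≢k′ = M-correct g′ d′ (trans (sym (find-update-≢ (g , d) (g′ , d′) b M k≢k′)) found)

  store-sound : ∀ {c} g d → Sound c (decideAt g d) → Sound (store g d ∘ c) (decideAt g d)
  store-sound {c} g d c-sound M M-correct with c M | c-sound M M-correct
  ... | b , _ | M₁-correct , true⇒eventually =
    update-correct g d b M₁-correct (eventuallyTrue⇒derivable ∘ true⇒eventually) ,
    true⇒eventually

  memoStep-sound : ∀ k → (∀ g d → Sound (decideMemo k g d) (decideAt g d)) →
                   ∀ g d → Sound (Cases.cases mor mand ret (decideMemo k) g d) (decideAt g d)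
  memoStep-sound k decideMemo-k-sound g d =
    sound-weaken eventuallyTrue-pointwise-cases
      (Parametricity.cases-∼ Sound mor mand ret (decideMemo k) _∨̇_ _∧̇_ const decideAt
         mor-sound mand-sound ret-sound decideMemo-k-sound g d)

  decideMemo-sound : ∀ n g d → Sound (decideMemo n g d) (decideAt g d)
  decideMemo-sound n g d M M-correct with find (g , d) M in found
  ... | just b = M-correct , λ { refl → derivable⇒eventuallyTrue (M-correct g d found) }
  decideMemo-sound zero    g d M M-correct | nothing =
    update-correct g d false M-correct (λ ()) , λ ()
  decideMemo-sound (suc k) g d M M-correct | nothing =
    store-sound g d (memoStep-sound k (decideMemo-sound k) g d) M M-correct

mainTheorem5 : (MM : MemoMap) → (n : ℕ) (g d : ATerm) (M : MemoMap.Map MM) →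
    Memo.Correct MM M →
    Memo.Correct MM (proj₂ (Memo.decideMemo MM n g d M))
    × (proj₁ (Memo.decideMemo MM n g d M) ≡ true → ∃ λ n₀ → decide n₀ g d ≡ true)
mainTheorem5 MM n g d M M-correct =
  map₂ (eventuallyTrue⇒derivable ∘_) (decideMemo-sound MM n g d M M-correct)
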